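{- Let $n \geq 5$ and $m \geq 1$ be integers and let $2 \leq s_2 < s_3 < \dots < s_m \leq \lfloor \frac{n-1}{2} \rfloor$ be integers. Let $C_n(1, s_2, \dots, s_m)$ be the circulant graph on vertex set $\{0,1,\dots,n-1\}$ in which $i$ and $j$ are adjacent iff $i - j \equiv \pm s_k \pmod n$ for some $k \in \{1,\dots,m\}$, where $s_1 = 1$. Call an edge $\{i, i\pm 1\}$ an outer edge and an edge $\{i, i\pm s_k\}$ with $2 \leq k \leq m$ an inner edge. Then for any two vertices $i$ and $j$ of $C_n(1, s_2, \dots, s_m)$, there exists a shortest path from $i$ to $j$ in which all outer edges are traversed before any inner edge (i.e., the path consists of a (possibly empty) sequence of outer edges followed by a (possibly empty) sequence of inner edges).
   Context: Indices are taken modulo $n$. When $m=1$ there are no inner edges. -}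

module Defs where

open import Data.Nat using (ℕ; zero; suc; _+_; _≤_; _<_; NonZero)
open import Data.Nat.DivMod using (_%_)
open import Data.Fin using (Fin; toℕ)
open import Data.Sum using (_⊎_)
open import Data.Unit using (⊤)
open import Data.Empty using (⊥)
open import Relation.Binary.PropositionalEquality using (_≡_)

-- The inner jumps s_2 < ... < s_m are given as  t : Fin k → ℕ  with k = m - 1
-- (t a = s_{a+2}); the outer jump is s_1 = 1.

Adj : (n : ℕ) .{{_ : NonZero n}} → ℕ → Fin n → Fin n → Set
Adj n s i j = (toℕ j ≡ (toℕ i + s) % n) ⊎ (toℕ i ≡ (toℕ j + s) % n)

data Walk (n : ℕ) .{{_ : NonZero n}} {k : ℕ} (t : Fin k → ℕ) : Fin n → Fin n → Set where
  nil   : ∀ {i} → Walk n t i i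
  outer : ∀ {i j l} → Adj n 1 i j → Walk n t j l → Walk n t i l
  inner : ∀ {i j l} (a : Fin k) → Adj n (t a) i j → Walk n t j l → Walk n t i l

length : ∀ {n} .{{_ : NonZero n}} {k} {t : Fin k → ℕ} {i j} → Walk n t i j → ℕ
length nil           = zero
length (outer _ w)   = suc (length w)
length (inner _ _ w) = suc (length w)

AllInner : ∀ {n} .{{_ : NonZero n}} {k} {t : Fin k → ℕ} {i j} → Walk n t i j → Set
AllInner nil           = ⊤
AllInner (outer _ _)   = ⊥
AllInner (inner _ _ w) = AllInner w

OuterThenInner : ∀ {n} .{{_ : NonZero n}} {k} {t : Fin k → ℕ} {i j} → Walk n t i j → Set
OuterThenInner nil             = ⊤
OuterThenInner (outer _ w)     = OuterThenInner w
OuterThenInner w@(inner _ _ _) = AllInner w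

-- Steps of a circulant graph are rotations of ℤ/n, and rotations commute, so every inner
-- step of a walk can be moved past the outer steps after it without changing the endpoints
-- or the length. Applied to a shortest walk (which exists because walks of bounded length
-- can be searched exhaustively), this yields a shortest walk with all outer edges first.
module Submission where

open import Defs
open import Data.Nat using (ℕ; zero; suc; _+_; _*_; _≤_; _<_; _∸_; z≤n; s≤s; NonZero)
open import Data.Nat.DivMod using (_/_; _%_; m%n<n; %-distribˡ-+; m%n%n≡m%n; [m+kn]%n≡m%n; m<n⇒m%n≡m)
open import Data.Nat.Properties as ℕ using (+-assoc; +-comm; *-suc)
open import Data.Fin using (Fin; toℕ; fromℕ<) renaming (_<_ to _<ᶠ_)
open import Data.Fin.Properties using (toℕ<n; toℕ-fromℕ<; toℕ-injective; any?) renaming (_≟_ to _≟ᶠ_)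
open import Data.Product using (Σ; ∃; _×_; _,_)
open import Data.Sum using (inj₁; inj₂)
open import Data.Unit using (tt)
open import Data.Empty using (⊥-elim)
open import Relation.Nullary using (Dec; yes; no)
open import Relation.Nullary.Decidable using (_×-dec_; _⊎-dec_)
open import Relation.Binary.PropositionalEquality
open import Function using (_∘_)

m*[n∸1]+m≡m*n : ∀ m n .{{_ : NonZero n}} → m * (n ∸ 1) + m ≡ m * n
m*[n∸1]+m≡m*n m (suc n-1) = trans (+-comm (m * n-1) m) (sym (*-suc m n-1))

module Circulant (n : ℕ) .{{_ : NonZero n}} where

  rotate : ℕ → Fin n → Fin n
  rotate d i = fromℕ< (m%n<n (toℕ i + d) n)

  toℕ-rotate : ∀ d i → toℕ (rotate d i) ≡ (toℕ i + d) % n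
  toℕ-rotate d i = toℕ-fromℕ< (m%n<n (toℕ i + d) n)

  rotate-+ : ∀ d e i → rotate e (rotate d i) ≡ rotate (d + e) i
  rotate-+ d e i = toℕ-injective (begin
    toℕ (rotate e (rotate d i))          ≡⟨ toℕ-rotate e (rotate d i) ⟩
    (toℕ (rotate d i) + e) % n           ≡⟨ cong (λ z → (z + e) % n) (toℕ-rotate d i) ⟩
    ((toℕ i + d) % n + e) % n            ≡⟨ %-distribˡ-+ ((toℕ i + d) % n) e n ⟩
    ((toℕ i + d) % n % n + e % n) % n    ≡⟨ cong (λ z → (z + e % n) % n) (m%n%n≡m%n (toℕ i + d) n) ⟩
    ((toℕ i + d) % n + e % n) % n        ≡⟨ %-distribˡ-+ (toℕ i + d) e n ⟨
    (toℕ i + d + e) % n                  ≡⟨ cong (_% n) (+-assoc (toℕ i) d e) ⟩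
    (toℕ i + (d + e)) % n                ≡⟨ toℕ-rotate (d + e) i ⟨
    toℕ (rotate (d + e) i)               ∎)
    where open ≡-Reasoning

  rotate-comm : ∀ d e i → rotate e (rotate d i) ≡ rotate d (rotate e i)
  rotate-comm d e i = begin
    rotate e (rotate d i)   ≡⟨ rotate-+ d e i ⟩
    rotate (d + e) i        ≡⟨ cong (λ z → rotate z i) (+-comm d e) ⟩
    rotate (e + d) i        ≡⟨ rotate-+ e d i ⟨
    rotate d (rotate e i)   ∎
    where open ≡-Reasoning

  rotate-multiple : ∀ c i → rotate (c * n) i ≡ i
  rotate-multiple c i = toℕ-injective (begin
    toℕ (rotate (c * n) i)   ≡⟨ toℕ-rotate (c * n) i ⟩
    (toℕ i + c * n) % n      ≡⟨ [m+kn]%n≡m%n (toℕ i) c n ⟩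
    toℕ i % n                ≡⟨ m<n⇒m%n≡m (toℕ<n i) ⟩
    toℕ i                    ∎)
    where open ≡-Reasoning

  rotate-zero : ∀ i → rotate 0 i ≡ i
  rotate-zero = rotate-multiple 0

  -- Rotating by s (n - 1) is rotating by -s.
  opposite : ℕ → ℕ
  opposite s = s * (n ∸ 1)

  opposite-+ : ∀ s → opposite s + s ≡ s * n
  opposite-+ s = m*[n∸1]+m≡m*n s n

  rotate-opposite : ∀ s i → rotate s (rotate (opposite s) i) ≡ i
  rotate-opposite s i = begin
    rotate s (rotate (opposite s) i)   ≡⟨ rotate-+ (opposite s) s i ⟩
    rotate (opposite s + s) i          ≡⟨ cong (λ z → rotate z i) (opposite-+ s) ⟩
    rotate (s * n) i                   ≡⟨ rotate-multiple s i ⟩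
    i                                  ∎
    where open ≡-Reasoning

  data Jump (s : ℕ) : ℕ → Set where
    forward  : Jump s s
    backward : Jump s (opposite s)

  Jump⇒Adj : ∀ {s d} → Jump s d → ∀ i → Adj n s i (rotate d i)
  Jump⇒Adj {s} forward  i = inj₁ (toℕ-rotate s i)
  Jump⇒Adj {s} backward i = inj₂ (begin
    toℕ i                                  ≡⟨ cong toℕ (rotate-opposite s i) ⟨
    toℕ (rotate s (rotate (opposite s) i)) ≡⟨ toℕ-rotate s _ ⟩
    (toℕ (rotate (opposite s) i) + s) % n  ∎)
    where open ≡-Reasoning

  Adj⇒Jump : ∀ {s i j} → Adj n s i j → ∃ λ d → Jump s d × j ≡ rotate d i
  Adj⇒Jump {s} {i} {j} (inj₁ j≡i+s) =
    s , forward , toℕ-injective (trans j≡i+s (sym (toℕ-rotate s i)))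
  Adj⇒Jump {s} {i} {j} (inj₂ i≡j+s) = opposite s , backward , (begin
    j                                        ≡⟨ rotate-opposite s j ⟨
    rotate s (rotate (opposite s) j)         ≡⟨ rotate-comm (opposite s) s j ⟩
    rotate (opposite s) (rotate s j)         ≡⟨ cong (rotate (opposite s)) i≡rotate ⟨
    rotate (opposite s) i                    ∎)
    where
      open ≡-Reasoning
      i≡rotate : i ≡ rotate s j
      i≡rotate = toℕ-injective (trans i≡j+s (sym (toℕ-rotate s j)))

  Adj-commute : ∀ {s s' x y z} → Adj n s x y → Adj n s' y z →
                ∃ λ y' → Adj n s' x y' × Adj n s y' z
  Adj-commute {x = x} xy yz with Adj⇒Jump xy | Adj⇒Jump yz
  ... | d , jd , refl | d' , jd' , refl =
    rotate d' x , Jump⇒Adj jd' x , subst (Adj n _ _) (sym (rotate-comm d d' x)) (Jump⇒Adj jd (rotate d' x))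

  module _ {k : ℕ} (t : Fin k → ℕ) where

    forwardWalk : ∀ m i → Walk n t i (rotate m i)
    forwardWalk zero    i = subst (Walk n t i) (sym (rotate-zero i)) nil
    forwardWalk (suc m) i =
      outer (Jump⇒Adj forward i) (subst (Walk n t _) (rotate-+ 1 m i) (forwardWalk m (rotate 1 i)))

    connected : ∀ i j → Walk n t i j
    connected i j = subst (Walk n t i) rotate-to-j (forwardWalk (toℕ j + opposite (toℕ i)) i)
      where
        rotate-to-j : rotate (toℕ j + opposite (toℕ i)) i ≡ j
        rotate-to-j = toℕ-injective (begin
          toℕ (rotate (toℕ j + opposite (toℕ i)) i)  ≡⟨ toℕ-rotate _ i ⟩
          (toℕ i + (toℕ j + opposite (toℕ i))) % n   ≡⟨ cong (_% n) (+-comm (toℕ i) _) ⟩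
          (toℕ j + opposite (toℕ i) + toℕ i) % n     ≡⟨ cong (_% n) (+-assoc (toℕ j) _ (toℕ i)) ⟩
          (toℕ j + (opposite (toℕ i) + toℕ i)) % n   ≡⟨ cong (λ z → (toℕ j + z) % n) (opposite-+ (toℕ i)) ⟩
          (toℕ j + toℕ i * n) % n                    ≡⟨ [m+kn]%n≡m%n (toℕ j) (toℕ i) n ⟩
          toℕ j % n                                  ≡⟨ m<n⇒m%n≡m (toℕ<n j) ⟩
          toℕ j                                      ∎)
          where open ≡-Reasoning

    SortedWalk : ∀ i j → ℕ → Set
    SortedWalk i j ℓ = Σ (Walk n t i j) λ w → OuterThenInner w × length w ≡ ℓ

    prependInner : ∀ {x y z} a → Adj n (t a) x y → (w : Walk n t y z) → OuterThenInner w →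
                   SortedWalk x z (suc (length w))
    prependInner a e nil           _ = inner a e nil , tt , refl
    prependInner a e w@(inner _ _ _) p = inner a e w , p , refl
    prependInner a e (outer e' w)  p with Adj-commute e e'
    ... | _ , e'' , e''' with prependInner a e''' w p
    ...   | w' , p' , ℓ' = outer e'' w' , p' , cong suc ℓ'

    sortWalk : ∀ {i j} (w : Walk n t i j) → SortedWalk i j (length w)
    sortWalk nil         = nil , tt , refl
    sortWalk (outer e w) with sortWalk w
    ... | w' , p , ℓ = outer e w' , p , cong suc ℓ
    sortWalk (inner a e w) with sortWalk w
    ... | w' , p , ℓ = subst (SortedWalk _ _ ∘ suc) ℓ (prependInner a e w' p)

    WalkWithin : Fin n → Fin n → ℕ → Set
    WalkWithin i j L = Σ (Walk n t i j) λ w → length w ≤ L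

    Adj? : ∀ s i j → Dec (Adj n s i j)
    Adj? s i j = (toℕ j ℕ.≟ (toℕ i + s) % n) ⊎-dec (toℕ i ℕ.≟ (toℕ j + s) % n)

    WalkWithin? : ∀ L i j → Dec (WalkWithin i j L)
    WalkWithin? L i j with i ≟ᶠ j
    WalkWithin? L i j | yes refl = yes (nil , z≤n)
    WalkWithin? zero i j | no i≢j =
      no λ { (nil , _) → i≢j refl ; (outer _ _ , ()) ; (inner _ _ _ , ()) }
    WalkWithin? (suc L) i j | no i≢j
      with any? (λ y → Adj? 1 i y ×-dec WalkWithin? L y j)
         | any? (λ a → any? (λ y → Adj? (t a) i y ×-dec WalkWithin? L y j))
    ... | yes (_ , e , w , ℓ) | _ = yes (outer e w , s≤s ℓ)
    ... | no _ | yes (a , _ , e , w , ℓ) = yes (inner a e w , s≤s ℓ)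
    ... | no no-outer | no no-inner = no λ
      { (nil , _)             → i≢j refl
      ; (outer e w , s≤s ℓ)   → no-outer (_ , e , w , ℓ)
      ; (inner a e w , s≤s ℓ) → no-inner (a , _ , e , w , ℓ) }

    Shortest : ∀ {i j} → Walk n t i j → Set
    Shortest {i} {j} w = (w' : Walk n t i j) → length w ≤ length w'

    shortestWithin : ∀ L {i j} (w : Walk n t i j) → length w ≤ L → Σ (Walk n t i j) Shortest
    shortestWithin zero    w ℓ = w , λ _ → ℕ.≤-trans ℓ z≤n
    shortestWithin (suc L) {i} {j} w ℓ with WalkWithin? L i j
    ... | yes (w' , ℓ') = shortestWithin L w' ℓ'
    ... | no none = w , shortest
      where
        shortest : Shortest w
        shortest w' with ℕ.≤-<-connex (length w) (length w')
        ... | inj₁ w≤w' = w≤w'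
        ... | inj₂ w'<w = ⊥-elim (none (w' , ℕ.≤-pred (ℕ.≤-trans w'<w ℓ)))

    shortestWalk : ∀ i j → Σ (Walk n t i j) Shortest
    shortestWalk i j = shortestWithin _ (connected i j) ℕ.≤-refl

    sortedShortestWalk : ∀ i j → Σ (Walk n t i j) λ w → OuterThenInner w × Shortest w
    sortedShortestWalk i j with shortestWalk i j
    ... | w , shortest with sortWalk w
    ...   | w' , sorted , ℓ = w' , sorted , λ w'' → subst (_≤ length w'') (sym ℓ) (shortest w'')

lemma2p5 : (n : ℕ) .{{_ : NonZero n}} → 5 ≤ n →
    (k : ℕ) (t : Fin k → ℕ) →
    (∀ (a b : Fin k) → a <ᶠ b → t a < t b) →
    (∀ a → 2 ≤ t a) →
    (∀ a → t a ≤ (n ∸ 1) / 2) →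
    (i j : Fin n) →
    Σ (Walk n t i j) (λ w → OuterThenInner w × ((w' : Walk n t i j) → length w ≤ length w'))
lemma2p5 n _ k t _ _ _ = Circulant.sortedShortestWalk n t
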